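{- Let $k\ge 1$ and $n_1,\dots,n_k \ge 2$ be integers with $n_1 \ge 3$. Then the Cartesian product $\mathrm{P} = \mathrm{P}_{n_1}\,\Box\,\cdots\,\Box\,\mathrm{P}_{n_k}$ has a maximal matching of size $|V(\mathrm{P})|/3$.
   Context: The permutahedron $\mathrm{P}_m$ is the graph whose vertices are the permutations of $[m]$ in one-line notation, two permutations being adjacent if one is obtained from the other by swapping the entries at two consecutive positions. The Cartesian product $G\,\Box\,H$ of graphs $G,H$ has vertex set $V(G)\times V(H)$, with $(u,v)$ adjacent to $(u',v')$ iff either $u=u'$ and $vv'\in E(H)$, or $v=v'$ and $uu'\in E(G)$. A maximal matching is a set of pairwise vertex-disjoint edges that is maximal with respect to inclusion. -}

module Defs where

open import Data.Nat using (ℕ; zero; suc; _*_)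
open import Data.Nat using (_!)
open import Data.Fin using (Fin; toℕ)
open import Data.Vec using (Vec; lookup; _[_]≔_)
open import Data.List using (List; []; _∷_; foldr; map; concatMap)
open import Data.List.Relation.Unary.All using (All; []; _∷_)
import Data.List.Relation.Unary.Unique.Propositional as ListU
import Data.Vec.Relation.Unary.Unique.Propositional as VecU
open import Data.List.Membership.Propositional using (_∈_; _∉_)
open import Data.Product using (Σ; ∃; _×_; _,_)
open import Data.Sum using (_⊎_)
open import Relation.Binary.PropositionalEquality using (_≡_)
open import Relation.Nullary using (¬_)

-- A word of length m over [m] = Fin m in one-line notation.
Word : ℕ → Set
Word m = Vec (Fin m) m

IsPerm : ∀ {m} → Word m → Set
IsPerm v = VecU.Unique v

swapAt : ∀ {m} → Word m → Fin m → Fin m → Word m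
swapAt v i j = (v [ i ]≔ lookup v j) [ j ]≔ lookup v i

PermAdj : ∀ {m} → Word m → Word m → Set
PermAdj {m} v w =
  Σ (Fin m) λ i → Σ (Fin m) λ j → (toℕ j ≡ suc (toℕ i)) × (w ≡ swapAt v i j)

Tuple : List ℕ → Set
Tuple ns = All Word ns

IsVertex : ∀ {ns} → Tuple ns → Set
IsVertex [] = Data.Unit.⊤
  where import Data.Unit
IsVertex (v ∷ vs) = IsPerm v × IsVertex vs

ProdAdj : ∀ {ns} → Tuple ns → Tuple ns → Set
ProdAdj [] [] = Data.Empty.⊥
  where import Data.Empty
ProdAdj (x ∷ xs) (y ∷ ys) = (PermAdj x y × xs ≡ ys) ⊎ (x ≡ y × ProdAdj xs ys)

IsEdge : ∀ {ns} → Tuple ns → Tuple ns → Set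
IsEdge u v = IsVertex u × IsVertex v × ProdAdj u v

-- Number of vertices of P: |V(P_m)| = m!, so |V(P)| = n_1! ⋯ n_k!.
numVertices : List ℕ → ℕ
numVertices ns = foldr _*_ 1 (map (λ m → m !) ns)

Edge : List ℕ → Set
Edge ns = Tuple ns × Tuple ns

endpoints : ∀ {ns} → List (Edge ns) → List (Tuple ns)
endpoints = concatMap (λ { (u , v) → u ∷ v ∷ [] })

-- A matching: a list of edges of P whose endpoints are pairwise distinct
-- (so the edges are pairwise vertex-disjoint, and no edge is listed twice).
IsMatching : ∀ {ns} → List (Edge ns) → Set
IsMatching M = All (λ { (u , v) → IsEdge u v }) M × ListU.Unique (endpoints M)

IsMaximalMatching : ∀ {ns} → List (Edge ns) → Set
IsMaximalMatching {ns} M =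
  IsMatching M ×
  (∀ (u v : Tuple ns) → IsEdge u v → (u , v) ∉ M → (v , u) ∉ M →
     ¬ IsMatching ((u , v) ∷ M))

{-# OPTIONS --safe #-}
module Submission where

-- Colour a permutation by its number of inversions mod 3, except that the inversions
-- among its last three entries a b c are replaced by hex a b c, the number of
-- neighbours of b exceeding b.  An adjacent transposition always changes this colour
-- (it suffices to compare at most four entries), and the arrangements of the last three
-- entries form a hexagon of transpositions along which hex runs through 0 1 2 0 1 2.
-- Adding the inversion counts mod 3 of the other factors gives a proper 3-colouring of
-- P = P_{n₁} □ ⋯ □ P_{n_k} together with a permutation `next` of V(P) along edges that
-- raises every colour by one.  The edges {t , next t} with t of colour 1 form a matching
-- covering exactly the vertices of colours 1 and 2.  It is maximal since colour 0 is an
-- independent set, and `next` maps each colour class bijectively onto the next one, so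
-- each class has |V(P)|/3 elements.

open import Defs

open import Data.Empty using (⊥-elim)
open import Data.Fin using (Fin; zero; suc; toℕ; _<_; punchIn; punchOut)
open import Data.Fin.Properties
  using (all?; _≟_; _<?_; <-cmp; <-asym; <-trans; punchIn-injective; punchInᵢ≢i; punchIn-punchOut)
open import Data.List using (List; []; _∷_; length; map; filter; cartesianProductWith; allFin; _++_)
import Data.List.Properties as Listₚ
open import Data.List.Membership.Propositional using (_∈_; _∉_)
open import Data.List.Membership.Propositional.Properties
  using (∈-cartesianProductWith⁺; ∈-cartesianProductWith⁻; ∈-allFin; ∈-filter⁺; ∈-filter⁻; ∈-map⁺)
open import Data.List.Relation.Binary.Subset.Propositional using (_⊆_)
open import Data.List.Relation.Unary.All using (All; []; _∷_)
import Data.List.Relation.Unary.All as ListAll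
import Data.List.Relation.Unary.All.Properties as ListAllₚ
import Data.List.Relation.Unary.AllPairs as AllPairs
open import Data.List.Relation.Unary.Any using (here; there; index; _─_)
import Data.List.Relation.Unary.Unique.Propositional as ListUnique
import Data.List.Relation.Unary.Unique.Propositional.Properties as ListUniqueₚ
open import Data.Nat using (ℕ; _≤_; _/_; _!)
import Data.Nat as ℕ
import Data.Nat.Properties as ℕₚ
open import Data.Nat.DivMod using (m*n/n≡m)
open import Data.Product using (Σ; _×_; _,_; proj₁; proj₂)
open import Data.Sum using (_⊎_; inj₁; inj₂)
open import Data.Vec using (Vec; []; _∷_; lookup; _[_]≔_)
import Data.Vec as Vec
import Data.Vec.Properties as Vecₚ
open import Data.Vec.Relation.Unary.All as VecAll using () renaming ([] to []ᵃ; _∷_ to _∷ᵃ_)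
import Data.Vec.Relation.Unary.All.Properties as VecAllₚ
open import Data.Vec.Relation.Unary.AllPairs using () renaming ([] to []ᵘ; _∷_ to _∷ᵘ_)
import Data.Vec.Relation.Unary.Unique.Propositional as VecUnique
import Data.Vec.Relation.Unary.Unique.Propositional.Properties as VecUniqueₚ
open import Function using (_∘_; id)
open import Relation.Binary.Definitions using (tri<; tri≈; tri>)
open import Relation.Binary.PropositionalEquality
  using (_≡_; _≢_; refl; sym; trans; cong; cong₂; subst; subst₂; ≢-sym; module ≡-Reasoning)
open import Relation.Nullary using (¬_; Dec; yes; no)
open import Relation.Nullary.Decidable using (from-yes; ¬?; _→-dec_; _×-dec_)

open ≡-Reasoning

ℤ₃ : Set
ℤ₃ = Fin 3

pattern 𝟘 = zero
pattern 𝟙 = suc zero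
pattern 𝟚 = suc (suc zero)

infixl 6 _⊕_
_⊕_ : ℤ₃ → ℤ₃ → ℤ₃
𝟘 ⊕ b = b
𝟙 ⊕ 𝟘 = 𝟙
𝟙 ⊕ 𝟙 = 𝟚
𝟙 ⊕ 𝟚 = 𝟘
𝟚 ⊕ 𝟘 = 𝟚
𝟚 ⊕ 𝟙 = 𝟘
𝟚 ⊕ 𝟚 = 𝟙

⊕-comm : ∀ a b → a ⊕ b ≡ b ⊕ a
⊕-comm = from-yes (all? λ a → all? λ b → a ⊕ b ≟ b ⊕ a)

⊕-cancelˡ : ∀ a b c → a ⊕ b ≡ a ⊕ c → b ≡ c
⊕-cancelˡ = from-yes (all? λ a → all? λ b → all? λ c → a ⊕ b ≟ a ⊕ c →-dec b ≟ c)

⊕-cancelʳ : ∀ a b c → a ⊕ c ≡ b ⊕ c → a ≡ b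
⊕-cancelʳ = from-yes (all? λ a → all? λ b → all? λ c → a ⊕ c ≟ b ⊕ c →-dec a ≟ b)

⊕-leftComm : ∀ a b c → a ⊕ (b ⊕ c) ≡ b ⊕ (a ⊕ c)
⊕-leftComm = from-yes (all? λ a → all? λ b → all? λ c → a ⊕ (b ⊕ c) ≟ b ⊕ (a ⊕ c))

⊕-rightComm : ∀ a b c → a ⊕ b ⊕ c ≡ a ⊕ c ⊕ b
⊕-rightComm = from-yes (all? λ a → all? λ b → all? λ c → a ⊕ b ⊕ c ≟ a ⊕ c ⊕ b)

⊕-inverse : ∀ a δ δ′ → δ ⊕ δ′ ≡ 𝟘 → a ⊕ δ ⊕ δ′ ≡ a
⊕-inverse = from-yes (all? λ a → all? λ δ → all? λ δ′ → δ ⊕ δ′ ≟ 𝟘 →-dec a ⊕ δ ⊕ δ′ ≟ a)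

PairwiseDistinct : ℤ₃ → ℤ₃ → ℤ₃ → Set
PairwiseDistinct p q r = p ≢ q × p ≢ r × q ≢ r

distinct-shift : ∀ p q r δ → PairwiseDistinct p q r → δ ≢ 𝟘 → q ≢ p ⊕ δ → r ≡ p ⊕ δ
distinct-shift = from-yes (all? λ p → all? λ q → all? λ r → all? λ δ →
  (¬? (p ≟ q) ×-dec ¬? (p ≟ r) ×-dec ¬? (q ≟ r)) →-dec ¬? (δ ≟ 𝟘) →-dec ¬? (q ≟ p ⊕ δ) →-dec r ≟ p ⊕ δ)

⊕-swapCancel : ∀ a b p q t → (a ⊕ p) ⊕ (q ⊕ t) ≡ (b ⊕ q) ⊕ (p ⊕ t) → a ≡ b
⊕-swapCancel = from-yes (all? λ a → all? λ b → all? λ p → all? λ q → all? λ t →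
  (a ⊕ p) ⊕ (q ⊕ t) ≟ (b ⊕ q) ⊕ (p ⊕ t) →-dec a ≟ b)

⊕-boundaryCancel : ∀ a b c d e a′ c′ →
  (a ⊕ (b ⊕ (c ⊕ 𝟘))) ⊕ (d ⊕ e) ≡ (a′ ⊕ (d ⊕ (c′ ⊕ 𝟘))) ⊕ (b ⊕ e) → a ⊕ c ≡ a′ ⊕ c′
⊕-boundaryCancel = from-yes (all? λ a → all? λ b → all? λ c → all? λ d → all? λ e → all? λ a′ → all? λ c′ →
  (a ⊕ (b ⊕ (c ⊕ 𝟘))) ⊕ (d ⊕ e) ≟ (a′ ⊕ (d ⊕ (c′ ⊕ 𝟘))) ⊕ (b ⊕ e) →-dec a ⊕ c ≟ a′ ⊕ c′)

indicator : ∀ {p} {P : Set p} → Dec P → ℤ₃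
indicator (yes _) = 𝟙
indicator (no _)  = 𝟘

indicator-≢-𝟙⊕ : ∀ {p q} {P : Set p} {Q : Set q} → (P → Q) →
  (P? : Dec P) (Q? : Dec Q) → indicator P? ≢ 𝟙 ⊕ indicator Q?
indicator-≢-𝟙⊕ P⇒Q (yes P) (yes _) = λ ()
indicator-≢-𝟙⊕ P⇒Q (yes P) (no ¬Q) = ⊥-elim (¬Q (P⇒Q P))
indicator-≢-𝟙⊕ P⇒Q (no _)  (yes _) = λ ()
indicator-≢-𝟙⊕ P⇒Q (no _)  (no _)  = λ ()

module _ {m : ℕ} where

  ⟦_<_⟧ : Fin m → Fin m → ℤ₃
  ⟦ x < y ⟧ = indicator (x <? y)

  ⟦<⟧-yes : ∀ {x y} → x < y → ⟦ x < y ⟧ ≡ 𝟙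
  ⟦<⟧-yes {x} {y} x<y with x <? y
  ... | yes _  = refl
  ... | no x≮y = ⊥-elim (x≮y x<y)

  ⟦<⟧-no : ∀ {x y} → y < x → ⟦ x < y ⟧ ≡ 𝟘
  ⟦<⟧-no {x} {y} y<x with x <? y
  ... | yes x<y = ⊥-elim (<-asym x<y y<x)
  ... | no _    = refl

  ⟦<⟧-flip : ∀ {x y} → x ≢ y → ⟦ x < y ⟧ ≢ ⟦ y < x ⟧
  ⟦<⟧-flip {x} {y} x≢y with <-cmp x y
  ... | tri< x<y _ _ rewrite ⟦<⟧-yes x<y | ⟦<⟧-no x<y = λ ()
  ... | tri≈ _ x≡y _ = ⊥-elim (x≢y x≡y)
  ... | tri> _ _ y<x rewrite ⟦<⟧-no y<x | ⟦<⟧-yes y<x = λ ()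

  hex : Fin m → Fin m → Fin m → ℤ₃
  hex a b c = ⟦ b < a ⟧ ⊕ ⟦ b < c ⟧

  hex-sym : ∀ a b c → hex a b c ≡ hex c b a
  hex-sym a b c = ⊕-comm ⟦ b < a ⟧ ⟦ b < c ⟧

  hex-swap : ∀ {u v} c → u ≢ v → hex u v c ≢ hex v u c
  hex-swap {u} {v} c u≢v with <-cmp u v
  ... | tri< u<v _ _ rewrite ⟦<⟧-no u<v | ⟦<⟧-yes u<v =
    indicator-≢-𝟙⊕ (<-trans u<v) (v <? c) (u <? c)
  ... | tri≈ _ u≡v _ = ⊥-elim (u≢v u≡v)
  ... | tri> _ _ v<u rewrite ⟦<⟧-yes v<u | ⟦<⟧-no v<u =
    ≢-sym (indicator-≢-𝟙⊕ (<-trans v<u) (u <? c) (v <? c))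

  hex-distinct : ∀ {a b c} → a ≢ b → a ≢ c → b ≢ c →
    PairwiseDistinct (hex a b c) (hex b a c) (hex a c b)
  hex-distinct {a} {b} {c} a≢b a≢c b≢c =
      hex-swap c a≢b
    , subst₂ _≢_ (hex-sym c b a) (hex-sym b c a) (hex-swap a (≢-sym b≢c))
    , subst₂ _≢_ (hex-sym c a b) refl (hex-swap b (≢-sym a≢c))

  boundary-≢ : ∀ {x a} c → x ≢ a → ⟦ a < x ⟧ ⊕ ⟦ c < x ⟧ ≢ ⟦ x < a ⟧ ⊕ ⟦ c < a ⟧
  boundary-≢ {x} {a} c x≢a with <-cmp x a
  ... | tri< x<a _ _ rewrite ⟦<⟧-no x<a | ⟦<⟧-yes x<a =
    indicator-≢-𝟙⊕ (λ c<x → <-trans c<x x<a) (c <? x) (c <? a)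
  ... | tri≈ _ x≡a _ = ⊥-elim (x≢a x≡a)
  ... | tri> _ _ a<x rewrite ⟦<⟧-yes a<x | ⟦<⟧-no a<x =
    ≢-sym (indicator-≢-𝟙⊕ (λ c<a → <-trans c<a a<x) (c <? a) (c <? x))

-- Colourings of permutahedra

data Consecutive : ∀ {n} → Fin n → Fin n → Set where
  first : ∀ {n} → Consecutive {ℕ.suc (ℕ.suc n)} zero (suc zero)
  later : ∀ {n} {i j : Fin n} → Consecutive i j → Consecutive (suc i) (suc j)

consecutive⁺ : ∀ {n} {i j : Fin n} → toℕ j ≡ ℕ.suc (toℕ i) → Consecutive i j
consecutive⁺ {i = zero}  {suc zero}    refl = first
consecutive⁺ {i = suc i} {suc j}       j≡1+i = later (consecutive⁺ (ℕₚ.suc-injective j≡1+i))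
consecutive⁺ {i = zero}  {zero}        ()
consecutive⁺ {i = zero}  {suc (suc _)} ()
consecutive⁺ {i = suc _} {zero}        ()

consecutive⁻ : ∀ {n} {i j : Fin n} → Consecutive i j → toℕ j ≡ ℕ.suc (toℕ i)
consecutive⁻ first     = refl
consecutive⁻ (later c) = cong ℕ.suc (consecutive⁻ c)

module _ {a} {A : Set a} where

  -- swapAt for vectors of any length and element type; the two agree definitionally.
  swapEntries : ∀ {n} → Vec A n → Fin n → Fin n → Vec A n
  swapEntries v i j = (v [ i ]≔ lookup v j) [ j ]≔ lookup v i

  swapEntries-involutive : ∀ {n} {i j : Fin n} (v : Vec A n) → Consecutive i j →
    swapEntries (swapEntries v i j) i j ≡ v
  swapEntries-involutive (x ∷ y ∷ v) first     = refl
  swapEntries-involutive (x ∷ v)     (later c) = cong (x ∷_) (swapEntries-involutive v c)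

  All-swapEntries : ∀ {p} {P : A → Set p} {n} {i j : Fin n} {v : Vec A n} → Consecutive i j →
    VecAll.All P v → VecAll.All P (swapEntries v i j)
  All-swapEntries first     (px ∷ᵃ py ∷ᵃ pv) = py ∷ᵃ px ∷ᵃ pv
  All-swapEntries (later c) (px ∷ᵃ pv)       = px ∷ᵃ All-swapEntries c pv

  Unique-swapEntries : ∀ {n} {i j : Fin n} {v : Vec A n} → Consecutive i j →
    VecUnique.Unique v → VecUnique.Unique (swapEntries v i j)
  Unique-swapEntries first ((x≢y ∷ᵃ x∉v) ∷ᵘ y∉v ∷ᵘ u) = (≢-sym x≢y ∷ᵃ y∉v) ∷ᵘ x∉v ∷ᵘ u
  Unique-swapEntries (later c) (x∉v ∷ᵘ u) = All-swapEntries c x∉v ∷ᵘ Unique-swapEntries c u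

module _ {m : ℕ} where

  countBelow : ∀ {n} → Fin m → Vec (Fin m) n → ℤ₃
  countBelow x []      = 𝟘
  countBelow x (y ∷ v) = ⟦ y < x ⟧ ⊕ countBelow x v

  countBelow-swapEntries : ∀ {n} {i j : Fin n} x (v : Vec (Fin m) n) → Consecutive i j →
    countBelow x (swapEntries v i j) ≡ countBelow x v
  countBelow-swapEntries x (y ∷ z ∷ v) first     = ⊕-leftComm ⟦ z < x ⟧ ⟦ y < x ⟧ (countBelow x v)
  countBelow-swapEntries x (y ∷ v)     (later c) = cong (⟦ y < x ⟧ ⊕_) (countBelow-swapEntries x v c)

  headSwap-≢ : ∀ {n} {x y} (s : Vec (Fin m) n) t → x ≢ y →
    (⟦ y < x ⟧ ⊕ countBelow x s) ⊕ (countBelow y s ⊕ t) ≢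
    (⟦ x < y ⟧ ⊕ countBelow y s) ⊕ (countBelow x s ⊕ t)
  headSwap-≢ {x = x} {y} s t x≢y =
    ⟦<⟧-flip (≢-sym x≢y) ∘ ⊕-swapCancel ⟦ y < x ⟧ ⟦ x < y ⟧ (countBelow x s) (countBelow y s) t

  consSwap-≢ : ∀ {n} {i j : Fin n} x (v : Vec (Fin m) n) → Consecutive i j → ∀ {a b} →
    a ≢ b → countBelow x v ⊕ a ≢ countBelow x (swapEntries v i j) ⊕ b
  consSwap-≢ x v c a≢b rewrite countBelow-swapEntries x v c = a≢b ∘ ⊕-cancelˡ _ _ _

  inversions : ∀ {n} → Vec (Fin m) n → ℤ₃
  inversions []      = 𝟘
  inversions (x ∷ v) = countBelow x v ⊕ inversions v

  inversions-proper : ∀ {n} {i j : Fin n} {v : Vec (Fin m) n} → VecUnique.Unique v →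
    Consecutive i j → inversions v ≢ inversions (swapEntries v i j)
  inversions-proper {v = x ∷ y ∷ s} ((x≢y ∷ᵃ _) ∷ᵘ _) first = headSwap-≢ s (inversions s) x≢y
  inversions-proper {v = x ∷ v}     (_ ∷ᵘ u)          (later c) =
    consSwap-≢ x v c (inversions-proper u c)

lastThree : ∀ k → Fin 3 → Fin (3 ℕ.+ k)
lastThree ℕ.zero    i = i
lastThree (ℕ.suc k) i = suc (lastThree k i)

lastThree-consecutive : ∀ k {i j : Fin 3} → Consecutive i j → Consecutive (lastThree k i) (lastThree k j)
lastThree-consecutive ℕ.zero    c = c
lastThree-consecutive (ℕ.suc k) c = later (lastThree-consecutive k c)

module _ {k : ℕ} where

  lastThree-consecutive₁ : Consecutive (lastThree k zero) (lastThree k (suc zero))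
  lastThree-consecutive₁ = lastThree-consecutive k first

  lastThree-consecutive₂ : Consecutive (lastThree k (suc zero)) (lastThree k (suc (suc zero)))
  lastThree-consecutive₂ = lastThree-consecutive k (later first)

module _ {a} {A : Set a} {k : ℕ} where

  hexSwap₁ hexSwap₂ : Vec A (3 ℕ.+ k) → Vec A (3 ℕ.+ k)
  hexSwap₁ v = swapEntries v (lastThree k zero) (lastThree k (suc zero))
  hexSwap₂ v = swapEntries v (lastThree k (suc zero)) (lastThree k (suc (suc zero)))

module _ {m : ℕ} where

  hexInversions : ∀ {k} → Vec (Fin m) (3 ℕ.+ k) → ℤ₃
  hexInversions {ℕ.zero}  (a ∷ b ∷ c ∷ []) = hex a b c
  hexInversions {ℕ.suc k} (x ∷ v)          = countBelow x v ⊕ hexInversions v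

  hexInversions-distinct : ∀ {k} {v : Vec (Fin m) (3 ℕ.+ k)} → VecUnique.Unique v →
    PairwiseDistinct (hexInversions v) (hexInversions (hexSwap₁ v)) (hexInversions (hexSwap₂ v))
  hexInversions-distinct {ℕ.zero} ((a≢b ∷ᵃ a≢c ∷ᵃ []ᵃ) ∷ᵘ (b≢c ∷ᵃ []ᵃ) ∷ᵘ _) = hex-distinct a≢b a≢c b≢c
  hexInversions-distinct {ℕ.suc k} {x ∷ v} (_ ∷ᵘ u)
    rewrite countBelow-swapEntries x v (lastThree-consecutive₁ {k = k})
          | countBelow-swapEntries x v (lastThree-consecutive₂ {k = k})
    with hexInversions-distinct u
  ... | p≢q , p≢r , q≢r = p≢q ∘ cancel , p≢r ∘ cancel , q≢r ∘ cancel
    where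
    cancel : ∀ {p q} → countBelow x v ⊕ p ≡ countBelow x v ⊕ q → p ≡ q
    cancel = ⊕-cancelˡ (countBelow x v) _ _

  hexInversions-proper : ∀ {k} {i j : Fin (3 ℕ.+ k)} {v : Vec (Fin m) (3 ℕ.+ k)} → VecUnique.Unique v →
    Consecutive i j → hexInversions v ≢ hexInversions (swapEntries v i j)
  hexInversions-proper {ℕ.zero} u first         = proj₁ (hexInversions-distinct u)
  hexInversions-proper {ℕ.zero} u (later first) = proj₁ (proj₂ (hexInversions-distinct u))
  hexInversions-proper {ℕ.zero} u (later (later (later ())))
  -- A swap across the boundary of the hexagon part: the comparisons with b cancel.
  hexInversions-proper {ℕ.suc ℕ.zero} {v = x ∷ a ∷ b ∷ c ∷ []} ((x≢a ∷ᵃ _) ∷ᵘ _) first =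
    boundary-≢ c x≢a ∘ ⊕-boundaryCancel ⟦ a < x ⟧ ⟦ b < x ⟧ ⟦ c < x ⟧ ⟦ b < a ⟧ ⟦ b < c ⟧ ⟦ x < a ⟧ ⟦ c < a ⟧
  hexInversions-proper {ℕ.suc (ℕ.suc k)} {v = x ∷ y ∷ s} ((x≢y ∷ᵃ _) ∷ᵘ _) first =
    headSwap-≢ s (hexInversions s) x≢y
  hexInversions-proper {ℕ.suc k} {v = x ∷ v} (_ ∷ᵘ u) (later c) =
    consSwap-≢ x v c (hexInversions-proper u c)

  hexStep : ∀ {k} → ℤ₃ → Vec (Fin m) (3 ℕ.+ k) → Vec (Fin m) (3 ℕ.+ k)
  hexStep δ v with hexInversions (hexSwap₁ v) ≟ hexInversions v ⊕ δ
  ... | yes _ = hexSwap₁ v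
  ... | no  _ = hexSwap₂ v

  hexStep-adjacent : ∀ {k} δ (v : Vec (Fin m) (3 ℕ.+ k)) →
    Σ (Fin (3 ℕ.+ k)) λ i → Σ (Fin (3 ℕ.+ k)) λ j → Consecutive i j × hexStep δ v ≡ swapEntries v i j
  hexStep-adjacent δ v with hexInversions (hexSwap₁ v) ≟ hexInversions v ⊕ δ
  ... | yes _ = _ , _ , lastThree-consecutive₁ , refl
  ... | no  _ = _ , _ , lastThree-consecutive₂ , refl

  Unique-hexStep : ∀ {k} δ {v : Vec (Fin m) (3 ℕ.+ k)} → VecUnique.Unique v → VecUnique.Unique (hexStep δ v)
  Unique-hexStep δ {v} u with hexStep-adjacent δ v
  ... | _ , _ , c , eq = subst VecUnique.Unique (sym eq) (Unique-swapEntries c u)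

  hexInversions-hexStep : ∀ {k} {δ} {v : Vec (Fin m) (3 ℕ.+ k)} → δ ≢ 𝟘 → VecUnique.Unique v →
    hexInversions (hexStep δ v) ≡ hexInversions v ⊕ δ
  hexInversions-hexStep {δ = δ} {v} δ≢𝟘 u with hexInversions (hexSwap₁ v) ≟ hexInversions v ⊕ δ
  ... | yes e  = e
  ... | no  ne = distinct-shift _ _ _ δ (hexInversions-distinct u) δ≢𝟘 ne

  hexStep-when₁ : ∀ {k} {δ} {v : Vec (Fin m) (3 ℕ.+ k)} →
    hexInversions (hexSwap₁ v) ≡ hexInversions v ⊕ δ → hexStep δ v ≡ hexSwap₁ v
  hexStep-when₁ {δ = δ} {v} e with hexInversions (hexSwap₁ v) ≟ hexInversions v ⊕ δ
  ... | yes _  = refl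
  ... | no  ne = ⊥-elim (ne e)

  hexStep-when₂ : ∀ {k} {δ} {v : Vec (Fin m) (3 ℕ.+ k)} →
    hexInversions (hexSwap₁ v) ≢ hexInversions v ⊕ δ → hexStep δ v ≡ hexSwap₂ v
  hexStep-when₂ {δ = δ} {v} ne with hexInversions (hexSwap₁ v) ≟ hexInversions v ⊕ δ
  ... | yes e = ⊥-elim (ne e)
  ... | no  _ = refl

  hexStep-inverse : ∀ {k} {δ δ′} {v : Vec (Fin m) (3 ℕ.+ k)} → δ ≢ 𝟘 → δ ⊕ δ′ ≡ 𝟘 →
    VecUnique.Unique v → hexStep δ′ (hexStep δ v) ≡ v
  hexStep-inverse {δ = δ} {δ′} {v} δ≢𝟘 δ⊕δ′≡𝟘 u
    with hexInversions (hexSwap₁ v) ≟ hexInversions v ⊕ δ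
  ... | yes e = trans (hexStep-when₁ back) (swapEntries-involutive v lastThree-consecutive₁)
    where
    back : hexInversions (hexSwap₁ (hexSwap₁ v)) ≡ hexInversions (hexSwap₁ v) ⊕ δ′
    back = begin
      hexInversions (hexSwap₁ (hexSwap₁ v))
        ≡⟨ cong hexInversions (swapEntries-involutive v lastThree-consecutive₁) ⟩
      hexInversions v                       ≡⟨ sym (⊕-inverse (hexInversions v) δ δ′ δ⊕δ′≡𝟘) ⟩
      hexInversions v ⊕ δ ⊕ δ′              ≡⟨ cong (_⊕ δ′) (sym e) ⟩
      hexInversions (hexSwap₁ v) ⊕ δ′       ∎
  ... | no ne = trans (hexStep-when₂ (proj₂ (proj₂ (hexInversions-distinct uw)) ∘ colours-collide)) w-back
    where
    w = hexSwap₂ v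
    uw : VecUnique.Unique w
    uw = Unique-swapEntries lastThree-consecutive₂ u
    w-back : hexSwap₂ w ≡ v
    w-back = swapEntries-involutive v lastThree-consecutive₂
    -- Going back by δ′ from w leads to hexSwap₂ w = v, so by distinctness at w not to hexSwap₁ w.
    colours-collide : hexInversions (hexSwap₁ w) ≡ hexInversions w ⊕ δ′ →
              hexInversions (hexSwap₁ w) ≡ hexInversions (hexSwap₂ w)
    colours-collide e = begin
      hexInversions (hexSwap₁ w) ≡⟨ e ⟩
      hexInversions w ⊕ δ′       ≡⟨ cong (_⊕ δ′) (distinct-shift _ _ _ δ (hexInversions-distinct u) δ≢𝟘 ne) ⟩
      hexInversions v ⊕ δ ⊕ δ′   ≡⟨ ⊕-inverse (hexInversions v) δ δ′ δ⊕δ′≡𝟘 ⟩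
      hexInversions v            ≡⟨ cong hexInversions (sym w-back) ⟩
      hexInversions (hexSwap₂ w) ∎

-- Colourings of products

WordColouringProper : ∀ {m} → (Word m → ℤ₃) → Set
WordColouringProper c = ∀ {v w} → IsPerm v → PermAdj v w → c v ≢ c w

ProperColouring : ∀ {ns} → (Tuple ns → ℤ₃) → Set
ProperColouring c = ∀ {u v} → IsVertex u → ProdAdj u v → c u ≢ c v

consecutiveSwaps⇒proper : ∀ {m} {c : Word m → ℤ₃} →
  (∀ {i j} {v} → IsPerm v → Consecutive i j → c v ≢ c (swapEntries v i j)) → WordColouringProper c
consecutiveSwaps⇒proper c-proper pv (i , j , j≡1+i , refl) = c-proper pv (consecutive⁺ j≡1+i)

_⊗_ : ∀ {n ns} → (Word n → ℤ₃) → (Tuple ns → ℤ₃) → Tuple (n ∷ ns) → ℤ₃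
(c ⊗ C) (v ∷ vs) = c v ⊕ C vs

⊗-proper : ∀ {n ns} {c : Word n → ℤ₃} {C : Tuple ns → ℤ₃} →
  WordColouringProper c → ProperColouring C → ProperColouring (c ⊗ C)
⊗-proper c-proper C-proper {_ ∷ _} {_ ∷ _} (pv , _)   (inj₁ (v~w , refl)) =
  c-proper pv v~w ∘ ⊕-cancelʳ _ _ _
⊗-proper c-proper C-proper {_ ∷ _} {_ ∷ _} (_  , pvs) (inj₂ (refl , vs~ws)) =
  C-proper pvs vs~ws ∘ ⊕-cancelˡ _ _ _

totalInversions : ∀ ns → Tuple ns → ℤ₃
totalInversions []       _ = 𝟘
totalInversions (n ∷ ns)   = inversions ⊗ totalInversions ns

totalInversions-proper : ∀ ns → ProperColouring (totalInversions ns)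
totalInversions-proper [] {[]} {[]} _ ()
totalInversions-proper (n ∷ ns) =
  ⊗-proper (consecutiveSwaps⇒proper inversions-proper) (totalInversions-proper ns)

-- Enumerating the vertices

module _ {a b c} {A : Set a} {B : Set b} {C : Set c} where

  length-cartesianProductWith : ∀ (f : A → B → C) xs ys →
    length (cartesianProductWith f xs ys) ≡ length xs ℕ.* length ys
  length-cartesianProductWith f []       ys = refl
  length-cartesianProductWith f (x ∷ xs) ys = begin
    length (map (f x) ys ++ cartesianProductWith f xs ys)     ≡⟨ Listₚ.length-++ (map (f x) ys) ⟩
    length (map (f x) ys) ℕ.+ length (cartesianProductWith f xs ys)
      ≡⟨ cong₂ ℕ._+_ (Listₚ.length-map (f x) ys) (length-cartesianProductWith f xs ys) ⟩
    length ys ℕ.+ length xs ℕ.* length ys                     ∎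

module _ {a b} {A : Set a} {B : Set b} {f : A → B} where

  Vec-map-injective : (∀ {x y} → f x ≡ f y → x ≡ y) →
    ∀ {n} {v w : Vec A n} → Vec.map f v ≡ Vec.map f w → v ≡ w
  Vec-map-injective f-inj {v = []}    {[]}    _  = refl
  Vec-map-injective f-inj {v = x ∷ v} {y ∷ w} eq =
    cong₂ _∷_ (f-inj (Vecₚ.∷-injectiveˡ eq)) (Vec-map-injective f-inj (Vecₚ.∷-injectiveʳ eq))

  Unique-map⁻ : ∀ {n} {v : Vec A n} → VecUnique.Unique (Vec.map f v) → VecUnique.Unique v
  Unique-map⁻ {v = []}    []ᵘ         = []ᵘ
  Unique-map⁻ {v = x ∷ v} (fx∉ ∷ᵘ u) =
    VecAll.map (λ fx≢fy x≡y → fx≢fy (cong f x≡y)) (VecAllₚ.map⁻ fx∉) ∷ᵘ Unique-map⁻ u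

module _ {n : ℕ} where

  prepend : ∀ {k} → Fin (ℕ.suc n) → Vec (Fin n) k → Vec (Fin (ℕ.suc n)) (ℕ.suc k)
  prepend x w = x ∷ Vec.map (punchIn x) w

  prepend-injective : ∀ {k} {x y} {v w : Vec (Fin n) k} → prepend x v ≡ prepend y w → x ≡ y × v ≡ w
  prepend-injective {x = x} eq with Vecₚ.∷-injective eq
  ... | refl , rest = refl , Vec-map-injective (punchIn-injective x _ _) rest

  Unique-prepend : ∀ {k} x {w : Vec (Fin n) k} → VecUnique.Unique w → VecUnique.Unique (prepend x w)
  Unique-prepend x {w} u =
      VecAllₚ.map⁺ (VecAll.universal (λ y → ≢-sym (punchInᵢ≢i x y)) w)
    ∷ᵘ VecUniqueₚ.map⁺ (punchIn-injective x _ _) u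

  punchOuts : ∀ {k} {x : Fin (ℕ.suc n)} {w : Vec (Fin (ℕ.suc n)) k} → VecAll.All (x ≢_) w → Vec (Fin n) k
  punchOuts []ᵃ           = []
  punchOuts (x≢y ∷ᵃ x∉w) = punchOut x≢y ∷ punchOuts x∉w

  map-punchIn-punchOuts : ∀ {k} {x : Fin (ℕ.suc n)} {w : Vec (Fin (ℕ.suc n)) k} (x∉w : VecAll.All (x ≢_) w) →
    Vec.map (punchIn x) (punchOuts x∉w) ≡ w
  map-punchIn-punchOuts []ᵃ           = refl
  map-punchIn-punchOuts (x≢y ∷ᵃ x∉w) = cong₂ _∷_ (punchIn-punchOut x≢y) (map-punchIn-punchOuts x∉w)

permutations : ∀ n → List (Word n)
permutations ℕ.zero    = [] ∷ []
permutations (ℕ.suc n) = cartesianProductWith prepend (allFin (ℕ.suc n)) (permutations n)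

length-permutations : ∀ n → length (permutations n) ≡ n !
length-permutations ℕ.zero    = refl
length-permutations (ℕ.suc n) =
  trans (length-cartesianProductWith prepend (allFin (ℕ.suc n)) (permutations n))
        (cong₂ ℕ._*_ (Listₚ.length-tabulate {n = ℕ.suc n} id) (length-permutations n))

Unique-permutations : ∀ n → ListUnique.Unique (permutations n)
Unique-permutations ℕ.zero    = [] AllPairs.∷ AllPairs.[]
Unique-permutations (ℕ.suc n) =
  ListUniqueₚ.cartesianProductWith⁺ prepend prepend-injective
    (ListUniqueₚ.allFin⁺ (ℕ.suc n)) (Unique-permutations n)

∈-permutations⁻ : ∀ {n} {w : Word n} → w ∈ permutations n → IsPerm w
∈-permutations⁻ {ℕ.zero}  {[]} _ = []ᵘ
∈-permutations⁻ {ℕ.suc n} w∈ with ∈-cartesianProductWith⁻ prepend (allFin (ℕ.suc n)) (permutations n) w∈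
... | x , v , _ , v∈ , refl = Unique-prepend x (∈-permutations⁻ v∈)

∈-permutations⁺ : ∀ {n} {w : Word n} → IsPerm w → w ∈ permutations n
∈-permutations⁺ {ℕ.zero}  {[]}    _           = here refl
∈-permutations⁺ {ℕ.suc n} {x ∷ w} (x∉w ∷ᵘ u) =
  subst (_∈ permutations (ℕ.suc n)) (cong (x ∷_) (map-punchIn-punchOuts x∉w))
    (∈-cartesianProductWith⁺ prepend (∈-allFin x) (∈-permutations⁺ u′))
  where
  u′ : VecUnique.Unique (punchOuts x∉w)
  u′ = Unique-map⁻ (subst VecUnique.Unique (sym (map-punchIn-punchOuts x∉w)) u)

vertices : ∀ ns → List (Tuple ns)
vertices []       = [] ∷ []
vertices (n ∷ ns) = cartesianProductWith _∷_ (permutations n) (vertices ns)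

length-vertices : ∀ ns → length (vertices ns) ≡ numVertices ns
length-vertices []       = refl
length-vertices (n ∷ ns) =
  trans (length-cartesianProductWith _∷_ (permutations n) (vertices ns))
        (cong₂ ℕ._*_ (length-permutations n) (length-vertices ns))

Unique-vertices : ∀ ns → ListUnique.Unique (vertices ns)
Unique-vertices []       = [] AllPairs.∷ AllPairs.[]
Unique-vertices (n ∷ ns) =
  ListUniqueₚ.cartesianProductWith⁺ _∷_ ∷-injective (Unique-permutations n) (Unique-vertices ns)
  where
  ∷-injective : ∀ {v w : Word n} {vs ws : Tuple ns} →
    _≡_ {A = Tuple (n ∷ ns)} (v ∷ vs) (w ∷ ws) → v ≡ w × vs ≡ ws
  ∷-injective refl = refl , refl

∈-vertices⁻ : ∀ {ns} {t : Tuple ns} → t ∈ vertices ns → IsVertex t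
∈-vertices⁻ {[]}     {[]} _ = _
∈-vertices⁻ {n ∷ ns} t∈ with ∈-cartesianProductWith⁻ _∷_ (permutations n) (vertices ns) t∈
... | v , vs , v∈ , vs∈ , refl = ∈-permutations⁻ v∈ , ∈-vertices⁻ vs∈

∈-vertices⁺ : ∀ {ns} {t : Tuple ns} → IsVertex t → t ∈ vertices ns
∈-vertices⁺ {[]}     {[]}     _          = here refl
∈-vertices⁺ {n ∷ ns} {v ∷ vs} (pv , pvs) = ∈-cartesianProductWith⁺ _∷_ (∈-permutations⁺ pv) (∈-vertices⁺ pvs)

-- Matchings from colour-shifting permutations

module _ {a} {A : Set a} where

  ∈-─ : ∀ {x y : A} {ys} (x∈ys : x ∈ ys) → y ∈ ys → y ≢ x → y ∈ (ys ─ x∈ys)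
  ∈-─ (here refl) (here refl) y≢x = ⊥-elim (y≢x refl)
  ∈-─ (here _)    (there y∈)  _   = y∈
  ∈-─ (there _)   (here refl) _   = here refl
  ∈-─ (there x∈)  (there y∈)  y≢x = there (∈-─ x∈ y∈ y≢x)

  Unique-⊆⇒length-≤ : ∀ {xs ys : List A} → ListUnique.Unique xs → xs ⊆ ys → length xs ℕ.≤ length ys
  Unique-⊆⇒length-≤ {[]}     _                   _  = ℕ.z≤n
  Unique-⊆⇒length-≤ {x ∷ xs} {ys} (x∉xs AllPairs.∷ u) xs⊆ys =
    ℕₚ.≤-trans (ℕ.s≤s (Unique-⊆⇒length-≤ u xs⊆ys─x))
               (ℕₚ.≤-reflexive (sym (Listₚ.length-removeAt′ ys (index x∈ys))))
    where
    x∈ys : x ∈ ys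
    x∈ys = xs⊆ys (here refl)
    xs⊆ys─x : xs ⊆ (ys ─ x∈ys)
    xs⊆ys─x y∈xs = ∈-─ x∈ys (xs⊆ys (there y∈xs)) (≢-sym (ListAll.lookup x∉xs y∈xs))

  colourClass : (A → ℤ₃) → ℤ₃ → List A → List A
  colourClass f c = filter (λ x → f x ≟ c)

  length-colourClasses : ∀ (f : A → ℤ₃) xs →
    length xs ≡ length (colourClass f 𝟘 xs) ℕ.+ length (colourClass f 𝟙 xs) ℕ.+ length (colourClass f 𝟚 xs)
  length-colourClasses f [] = refl
  length-colourClasses f (x ∷ xs) with f x | length-colourClasses f xs
  ... | 𝟘 | ih = cong ℕ.suc ih
  ... | 𝟙 | ih = trans (cong ℕ.suc ih) (cong (ℕ._+ length (colourClass f 𝟚 xs))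
                   (sym (ℕₚ.+-suc (length (colourClass f 𝟘 xs)) (length (colourClass f 𝟙 xs)))))
  ... | 𝟚 | ih = trans (cong ℕ.suc ih)
                   (sym (ℕₚ.+-suc (length (colourClass f 𝟘 xs) ℕ.+ length (colourClass f 𝟙 xs))
                                   (length (colourClass f 𝟚 xs))))

module _ {ns : List ℕ} (f : Tuple ns → Tuple ns) where

  pairsWith : List (Tuple ns) → List (Edge ns)
  pairsWith = map (λ t → t , f t)

  ∈-endpoints⁺ˡ : ∀ {t xs} → t ∈ xs → t ∈ endpoints (pairsWith xs)
  ∈-endpoints⁺ˡ (here refl) = here refl
  ∈-endpoints⁺ˡ (there t∈)  = there (there (∈-endpoints⁺ˡ t∈))

  ∈-endpoints⁺ʳ : ∀ {t xs} → t ∈ xs → f t ∈ endpoints (pairsWith xs)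
  ∈-endpoints⁺ʳ (here refl) = there (here refl)
  ∈-endpoints⁺ʳ (there t∈)  = there (there (∈-endpoints⁺ʳ t∈))

  ∈-endpoints⁻ : ∀ {z} xs → z ∈ endpoints (pairsWith xs) → Σ (Tuple ns) λ t → t ∈ xs × (z ≡ t ⊎ z ≡ f t)
  ∈-endpoints⁻ (x ∷ xs) (here z≡x)         = x , here refl , inj₁ z≡x
  ∈-endpoints⁻ (x ∷ xs) (there (here z≡fx)) = x , here refl , inj₂ z≡fx
  ∈-endpoints⁻ (x ∷ xs) (there (there z∈))  with ∈-endpoints⁻ xs z∈
  ... | t , t∈ , z≡ = t , there t∈ , z≡

  Unique-endpoints : ∀ {xs} → ListUnique.Unique xs →
    (∀ {x y} → x ∈ xs → y ∈ xs → x ≢ f y) →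
    (∀ {x y} → x ∈ xs → y ∈ xs → f x ≡ f y → x ≡ y) →
    ListUnique.Unique (endpoints (pairsWith xs))
  Unique-endpoints {[]}     _                     _   _     = AllPairs.[]
  Unique-endpoints {x ∷ xs} (x∉xs AllPairs.∷ u) x≢f f-inj =
    (x≢f (here refl) (here refl) ∷ ListAll.tabulate x-fresh) AllPairs.∷
    ListAll.tabulate fx-fresh AllPairs.∷
    Unique-endpoints u (λ p q → x≢f (there p) (there q)) (λ p q → f-inj (there p) (there q))
    where
    x-fresh : ∀ {z} → z ∈ endpoints (pairsWith xs) → x ≢ z
    x-fresh z∈ with ∈-endpoints⁻ xs z∈
    ... | t , t∈ , inj₁ refl = ListAll.lookup x∉xs t∈
    ... | t , t∈ , inj₂ refl = x≢f (here refl) (there t∈)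
    fx-fresh : ∀ {z} → z ∈ endpoints (pairsWith xs) → f x ≢ z
    fx-fresh z∈ with ∈-endpoints⁻ xs z∈
    ... | t , t∈ , inj₁ refl = ≢-sym (x≢f (there t∈) (here refl))
    ... | t , t∈ , inj₂ refl = ListAll.lookup x∉xs t∈ ∘ f-inj (here refl) (there t∈)

record ShiftingColouring (ns : List ℕ) : Set where
  field
    colour        : Tuple ns → ℤ₃
    next prev     : Tuple ns → Tuple ns
    colour-proper : ProperColouring colour
    next-adjacent : ∀ {t} → IsVertex t → ProdAdj t (next t)
    next-vertex   : ∀ {t} → IsVertex t → IsVertex (next t)
    prev-vertex   : ∀ {t} → IsVertex t → IsVertex (prev t)
    colour-next   : ∀ {t} → IsVertex t → colour (next t) ≡ colour t ⊕ 𝟙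
    prev-next     : ∀ {t} → IsVertex t → prev (next t) ≡ t
    next-prev     : ∀ {t} → IsVertex t → next (prev t) ≡ t

module ShiftingMatching {ns} (S : ShiftingColouring ns) where
  open ShiftingColouring S

  class : ℤ₃ → List (Tuple ns)
  class c = colourClass colour c (vertices ns)

  ∈-class⁻ : ∀ {c t} → t ∈ class c → IsVertex t × colour t ≡ c
  ∈-class⁻ {c} t∈ with ∈-filter⁻ (λ t → colour t ≟ c) {xs = vertices ns} t∈
  ... | t∈V , ct = ∈-vertices⁻ t∈V , ct

  ∈-class⁺ : ∀ {c t} → IsVertex t → colour t ≡ c → t ∈ class c
  ∈-class⁺ {c} pt ct = ∈-filter⁺ (λ t → colour t ≟ c) (∈-vertices⁺ pt) ct

  Unique-class : ∀ c → ListUnique.Unique (class c)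
  Unique-class c = ListUniqueₚ.filter⁺ (λ t → colour t ≟ c) (Unique-vertices ns)

  prev-∈-class : ∀ {c t} → t ∈ class (c ⊕ 𝟙) → prev t ∈ class c
  prev-∈-class {c} {t} t∈ with ∈-class⁻ t∈
  ... | pt , ct = ∈-class⁺ (prev-vertex pt) (⊕-cancelʳ _ c 𝟙 (begin
    colour (prev t) ⊕ 𝟙     ≡⟨ sym (colour-next (prev-vertex pt)) ⟩
    colour (next (prev t))  ≡⟨ cong colour (next-prev pt) ⟩
    colour t                ≡⟨ ct ⟩
    c ⊕ 𝟙                   ∎))

  length-class-≤ : ∀ c → length (class (c ⊕ 𝟙)) ℕ.≤ length (class c)
  length-class-≤ c = ℕₚ.≤-trans (Unique-⊆⇒length-≤ (Unique-class (c ⊕ 𝟙)) class⊆)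
                                 (ℕₚ.≤-reflexive (Listₚ.length-map next (class c)))
    where
    class⊆ : class (c ⊕ 𝟙) ⊆ map next (class c)
    class⊆ t∈ = subst (_∈ map next (class c)) (next-prev (proj₁ (∈-class⁻ t∈)))
                      (∈-map⁺ next (prev-∈-class t∈))

  numVertices≡length-class𝟙*3 : numVertices ns ≡ length (class 𝟙) ℕ.* 3
  numVertices≡length-class𝟙*3 = begin
    numVertices ns                                              ≡⟨ sym (length-vertices ns) ⟩
    length (vertices ns)                                        ≡⟨ length-colourClasses colour (vertices ns) ⟩
    length (class 𝟘) ℕ.+ length (class 𝟙) ℕ.+ length (class 𝟚) ≡⟨ cong₂ (λ a b → a ℕ.+ c₁ ℕ.+ b) c₀≡c₁ c₂≡c₁ ⟩
    c₁ ℕ.+ c₁ ℕ.+ c₁                                            ≡⟨ ℕₚ.+-assoc c₁ c₁ c₁ ⟩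
    c₁ ℕ.+ (c₁ ℕ.+ c₁)
      ≡⟨ cong (λ x → c₁ ℕ.+ (c₁ ℕ.+ x)) (sym (ℕₚ.+-identityʳ c₁)) ⟩
    3 ℕ.* c₁                                                    ≡⟨ ℕₚ.*-comm 3 c₁ ⟩
    c₁ ℕ.* 3                                                    ∎
    where
    c₁ = length (class 𝟙)
    c₀≡c₁ : length (class 𝟘) ≡ c₁
    c₀≡c₁ = ℕₚ.≤-antisym (ℕₚ.≤-trans (length-class-≤ 𝟚) (length-class-≤ 𝟙)) (length-class-≤ 𝟘)
    c₂≡c₁ : length (class 𝟚) ≡ c₁
    c₂≡c₁ = ℕₚ.≤-antisym (length-class-≤ 𝟙) (ℕₚ.≤-trans (length-class-≤ 𝟘) (length-class-≤ 𝟚))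

  matching : List (Edge ns)
  matching = pairsWith next (class 𝟙)

  Unique-matching : ListUnique.Unique (endpoints matching)
  Unique-matching = Unique-endpoints next (Unique-class 𝟙) x≢next next-injective
    where
    𝟙≢𝟚 : _≢_ {A = ℤ₃} 𝟙 𝟚
    𝟙≢𝟚 ()
    x≢next : ∀ {x y} → x ∈ class 𝟙 → y ∈ class 𝟙 → x ≢ next y
    x≢next {x} {y} x∈ y∈ x≡ny with ∈-class⁻ x∈ | ∈-class⁻ y∈
    ... | _ , cx | py , cy = 𝟙≢𝟚 (begin
      𝟙                ≡⟨ sym cx ⟩
      colour x         ≡⟨ cong colour x≡ny ⟩
      colour (next y)  ≡⟨ colour-next py ⟩
      colour y ⊕ 𝟙     ≡⟨ cong (_⊕ 𝟙) cy ⟩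
      𝟚                ∎)
    next-injective : ∀ {x y} → x ∈ class 𝟙 → y ∈ class 𝟙 → next x ≡ next y → x ≡ y
    next-injective {x} {y} x∈ y∈ nx≡ny = begin
      x                ≡⟨ sym (prev-next (proj₁ (∈-class⁻ x∈))) ⟩
      prev (next x)    ≡⟨ cong prev nx≡ny ⟩
      prev (next y)    ≡⟨ prev-next (proj₁ (∈-class⁻ y∈)) ⟩
      y                ∎

  matching-edges : ListAll.All (λ { (u , v) → IsEdge u v }) matching
  matching-edges = ListAllₚ.map⁺ (ListAll.tabulate λ t∈ →
    let pt = proj₁ (∈-class⁻ t∈) in pt , next-vertex pt , next-adjacent pt)

  covered : ∀ {w} → IsVertex w → colour w ≢ 𝟘 → w ∈ endpoints matching
  covered {w} pw cw≢𝟘 with colour w in cw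
  ... | 𝟘 = ⊥-elim (cw≢𝟘 refl)
  ... | 𝟙 = ∈-endpoints⁺ˡ next (∈-class⁺ pw cw)
  ... | 𝟚 = subst (_∈ endpoints matching) (next-prev pw)
                  (∈-endpoints⁺ʳ next (prev-∈-class {𝟙} (∈-class⁺ pw cw)))

  maximal : ∀ u v → IsEdge u v → (u , v) ∉ matching → (v , u) ∉ matching →
    ¬ IsMatching ((u , v) ∷ matching)
  maximal u v (pu , pv , u~v) _ _ (_ , (_ ∷ u∉E) AllPairs.∷ v∉E AllPairs.∷ _) with colour u ≟ 𝟘
  ... | yes cu≡𝟘 = ListAll.lookup v∉E (covered pv (colour-proper pu u~v ∘ trans cu≡𝟘 ∘ sym)) refl
  ... | no  cu≢𝟘 = ListAll.lookup u∉E (covered pu cu≢𝟘) refl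

  maximalMatching : Σ (List (Edge ns)) λ M → IsMaximalMatching M × length M ≡ numVertices ns / 3
  maximalMatching = matching , ((matching-edges , Unique-matching) , maximal) , (begin
    length matching                  ≡⟨ Listₚ.length-map _ (class 𝟙) ⟩
    length (class 𝟙)                 ≡⟨ sym (m*n/n≡m (length (class 𝟙)) 3) ⟩
    length (class 𝟙) ℕ.* 3 / 3       ≡⟨ cong (_/ 3) (sym numVertices≡length-class𝟙*3) ⟩
    numVertices ns / 3               ∎)

onFirst : ∀ {n ns} → (Word n → Word n) → Tuple (n ∷ ns) → Tuple (n ∷ ns)
onFirst f (v ∷ vs) = f v ∷ vs

permAdj-hexStep : ∀ {k} δ (v : Word (3 ℕ.+ k)) → PermAdj v (hexStep δ v)
permAdj-hexStep δ v with hexStep-adjacent δ v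
... | i , j , c , eq = i , j , consecutive⁻ c , eq

hexagonShifting : ∀ k rest → ShiftingColouring (3 ℕ.+ k ∷ rest)
hexagonShifting k rest = record
  { colour        = hexInversions ⊗ totalInversions rest
  ; next          = onFirst (hexStep 𝟙)
  ; prev          = onFirst (hexStep 𝟚)
  ; colour-proper = ⊗-proper (consecutiveSwaps⇒proper hexInversions-proper) (totalInversions-proper rest)
  ; next-adjacent = λ { {v ∷ _} _ → inj₁ (permAdj-hexStep 𝟙 v , refl) }
  ; next-vertex   = λ { {_ ∷ _} (pv , pvs) → Unique-hexStep 𝟙 pv , pvs }
  ; prev-vertex   = λ { {_ ∷ _} (pv , pvs) → Unique-hexStep 𝟚 pv , pvs }
  ; colour-next   = λ { {v ∷ vs} (pv , _) →
      trans (cong (_⊕ totalInversions rest vs) (hexInversions-hexStep (λ ()) pv))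
            (⊕-rightComm (hexInversions v) 𝟙 (totalInversions rest vs)) }
  ; prev-next     = λ { {_ ∷ vs} (pv , _) → cong (_∷ vs) (hexStep-inverse (λ ()) refl pv) }
  ; next-prev     = λ { {_ ∷ vs} (pv , _) → cong (_∷ vs) (hexStep-inverse (λ ()) refl pv) }
  }

proposition6p5 : (n₁ : ℕ) (rest : List ℕ) → 3 ≤ n₁ → All (2 ≤_) rest →
    Σ (List (Edge (n₁ ∷ rest))) λ M →
      IsMaximalMatching M × (length M ≡ numVertices (n₁ ∷ rest) / 3)
proposition6p5 (ℕ.suc (ℕ.suc (ℕ.suc k))) rest (ℕ.s≤s (ℕ.s≤s (ℕ.s≤s ℕ.z≤n))) _ =
  ShiftingMatching.maximalMatching (hexagonShifting k rest)
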